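{- Let $M$ be a connected matroid. Then: (i) $\delta M=\emptyset$ if and only if $M\cong U_1^1$; (ii) $\delta M\cong U_1^1$ if and only if $M\cong U_{n+1}^n$ for some $n$; (iii) $\delta M\cong U_{n+1}^n$ for some $n$ if and only if $M$ is a tricycle and $n=2$.
   Context: $U_m^r$ denotes the uniform matroid of rank $r$ on $m$ elements; $\emptyset$ denotes the matroid with empty ground set. For a matroid $M$ on $E$ with circuit set $\mathcal{C}$, $r(S)$ is the maximum size of a circuit-free subset of $S\subseteq E$ and $\eta(S)=|S|-r(S)$. For a family $\mathcal{X}$ of subsets of a finite set $X$: $\epsilon(\mathcal{X})=\mathcal{X}\cup\{(A_1\cup A_2)\setminus\{v\}: A_1,A_2\in\mathcal{X},\ A_1\cap A_2\notin\mathcal{X},\ v\in A_1\cap A_2\}$; ${\uparrow}\mathcal{X}=\{A\subseteq X:\exists A'\in\mathcal{X},A'\subseteq A\}$. The combinatorial derived matroid $\delta M$ is the matroid on ground set $\mathcal{C}$ whose dependent sets are the members of $\mathcal{A}=\bigcup_i\mathcal{A}_i$, where $\mathcal{A}_0=\{A\subseteq\mathcal{C}:|A|>\eta(\bigcup_{C\in A}C)\}$ and $\mathcal{A}_{i+1}={\uparrow}\epsilon(\mathcal{A}_i)$. A matroid $(E,\mathcal{C})$ is a tricycle if $\mathcal{C}=\{C_1,C_2,C_3\}$ has exactly three circuits with $C_i\cap C_j\neq\emptyset$ and $C_i\cup C_j=E$ for all $i\neq j$, and $C_1\cap C_2\cap C_3=\emptyset$. -}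

module Defs where

open import Data.Nat using (ℕ; zero; suc; _<_; _∸_; _⊔_)
open import Data.Fin using (Fin)
open import Data.Fin.Subset using (Subset; _∈_; _⊆_; _∩_; _∪_; _-_; ∣_∣; Nonempty; ⊥; ⊤)
open import Data.Fin.Subset.Properties using (_⊆?_)
open import Data.Bool using (Bool; true; false; if_then_else_)
open import Data.Vec using (Vec; []; _∷_; lookup; tabulate)
open import Data.List using (List; []; _∷_; map; _++_; foldr; allFin; filterᵇ)
open import Data.Empty renaming (⊥ to False)
open import Data.Product using (Σ; ∃; ∃₂; _×_; _,_)
open import Data.Sum using (_⊎_)
open import Relation.Nullary using (¬_; Dec; yes; no)
open import Relation.Nullary.Decidable using (⌊_⌋)
open import Relation.Binary.PropositionalEquality using (_≡_; _≢_)
open import Function.Bundles using (_↔_; Inverse; _⇔_)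
import Data.Bool as B

-- The circuits are listed without repetition as  circ : Fin m → Subset n
-- (injectivity follows from `incomparable`).

record Matroid : Set where
  field
    n            : ℕ
    m            : ℕ
    circ         : Fin m → Subset n
    nonempty     : ∀ i → Nonempty (circ i)
    incomparable : ∀ i j → circ i ⊆ circ j → i ≡ j
    elimination  : ∀ i j → i ≢ j → ∀ e → e ∈ circ i → e ∈ circ j →
                   ∃ λ k → circ k ⊆ ((circ i ∪ circ j) - e)

open Matroid public

allSubsets : (n : ℕ) → List (Subset n)
allSubsets zero    = [] ∷ []
allSubsets (suc n) = map (true ∷_) (allSubsets n) ++ map (false ∷_) (allSubsets n)

maximum : List ℕ → ℕ
maximum = foldr _⊔_ 0

module _ (M : Matroid) where

  circuitFree? : Subset (n M) → Bool
  circuitFree? I = foldr (λ i acc → B.not ⌊ circ M i ⊆? I ⌋ B.∧ acc) true (allFin (m M))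

  rank : Subset (n M) → ℕ
  rank S = maximum (map ∣_∣ (filterᵇ (λ I → ⌊ I ⊆? S ⌋ B.∧ circuitFree? I)
                                    (allSubsets (n M))))

  nullity : Subset (n M) → ℕ
  nullity S = ∣ S ∣ ∸ rank S

  unionOf : Subset (m M) → Subset (n M)
  unionOf A = foldr (λ i acc → if lookup A i then circ M i ∪ acc else acc) ⊥ (allFin (m M))

record DepSystem : Set₁ where
  field
    size : ℕ
    Dep  : Subset size → Set

open DepSystem public

image : ∀ {a b} → Fin a ↔ Fin b → Subset a → Subset b
image φ A = tabulate (λ y → lookup A (Inverse.from φ y))

_≅_ : DepSystem → DepSystem → Set
D₁ ≅ D₂ = Σ (Fin (size D₁) ↔ Fin (size D₂)) λ φ →
            ∀ A → Dep D₁ A ⇔ Dep D₂ (image φ A)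

toDS : Matroid → DepSystem
toDS M = record { size = n M ; Dep = λ S → ∃ λ i → circ M i ⊆ S }

-- the uniform matroid U^r_k (rank r on k elements): S dependent iff |S| > r
U : (r k : ℕ) → DepSystem
U r k = record { size = k ; Dep = λ S → r < ∣ S ∣ }

emptyM : DepSystem
emptyM = record { size = 0 ; Dep = λ _ → False }

ε : ∀ {k} → (Subset k → Set) → (Subset k → Set)
ε 𝒳 A = 𝒳 A ⊎ (∃₂ λ A₁ A₂ → 𝒳 A₁ × 𝒳 A₂ × ¬ 𝒳 (A₁ ∩ A₂) ×
                  ∃ λ v → v ∈ (A₁ ∩ A₂) × A ≡ ((A₁ ∪ A₂) - v))

↑ : ∀ {k} → (Subset k → Set) → (Subset k → Set)
↑ 𝒳 A = ∃ λ A′ → 𝒳 A′ × A′ ⊆ A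

𝒜 : (M : Matroid) → ℕ → Subset (m M) → Set
𝒜 M zero    A = nullity M (unionOf M A) < ∣ A ∣
𝒜 M (suc i) A = ↑ (ε (𝒜 M i)) A

δ : Matroid → DepSystem
δ M = record { size = m M ; Dep = λ A → ∃ λ i → 𝒜 M i A }

-- Connectedness: every two distinct elements lie in a common circuit.
-- (Convention: a connected matroid has nonempty ground set.)

Connected : Matroid → Set
Connected M = (0 < n M) ×
              (∀ e f → e ≢ f → ∃ λ i → e ∈ circ M i × f ∈ circ M i)

Tricycle : Matroid → Set
Tricycle M = (m M ≡ 3) ×
  (∀ i j → i ≢ j → Nonempty (circ M i ∩ circ M j) × (circ M i ∪ circ M j) ≡ ⊤) ×
  (∀ i j k → i ≢ j → j ≢ k → i ≢ k → (circ M i ∩ circ M j ∩ circ M k) ≡ ⊥)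

-- δM has the circuits of M as ground set, so δM ≅ U^k_{k+1} means that M has k + 1 circuits
-- and only the set ⊤ of all circuits is dependent in δM; since ε and ↑ preserve "no member"
-- and "only ⊤", it suffices to look at 𝒜₀.  The union of a nonempty set of circuits has
-- nullity ≥ 1, so with at most one circuit δM has no dependent set: this gives (i) and (ii),
-- as the unique circuit of a connected matroid is its whole ground set.  For (iii), two
-- meeting circuits eliminate to a third, so a connected matroid never has exactly two
-- circuits, and three circuits form a tricycle, where the union of any two circuits is E,
-- every independent set misses two elements of E, and nullity(E) = 2.  With at least four
-- circuits fix a basis I: two meeting fundamental circuits and a circuit eliminating a common
-- element form three circuits of nullity at most 2, a dependent set of δM other than ⊤.  If
-- ⊤ were the only one, every circuit would be fundamental (by induction on |C ∖ I|), and
-- connectedness provides a meeting pair.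

module Submission where

open import Defs
open import Data.Nat using (ℕ; zero; suc; _≤_; _<_; z≤n; s≤s; _+_; _∸_)
import Data.Nat.Properties as ℕ
open import Data.Fin using (Fin; zero; suc; _≟_; fromℕ<)
open import Data.Fin.Patterns using (0F; 1F; 2F)
open import Data.Fin.Permutation using (↔⇒≡)
import Data.Fin.Properties as Fin
open import Data.Fin.Subset
open import Data.Fin.Subset.Properties
open import Data.Bool using (Bool; true; false; T; not; _∧_; if_then_else_)
import Data.Bool.Properties as Bool
open import Data.Vec using (_∷_; []; here; there; lookup)
import Data.Vec.Properties as Vec
open import Data.List using (List; []; _∷_; map; foldr; allFin; filterᵇ)
open import Data.List.Membership.Propositional using () renaming (_∈_ to _∈ₗ_)
import Data.List.Membership.Propositional.Properties as List
open import Data.List.Relation.Unary.Any using (Any)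
open import Data.List.Relation.Unary.All as All using (All)
open import Data.Empty using (⊥-elim) renaming (⊥ to False)
open import Data.Product using (∃; ∃₂; _×_; _,_; proj₁; proj₂)
open import Data.Sum using (_⊎_; inj₁; inj₂)
open import Function using (id; _∘_; _⇔_; _↔_; mk⇔; mk↔ₛ′; Equivalence; Inverse)
open import Function.Construct.Identity using (↔-id)
import Function.Properties.Equivalence as ⇔
open import Relation.Nullary using (¬_; yes; no; contradiction)
open import Relation.Nullary.Decidable using (⌊_⌋; T?; toWitness; fromWitness)
open import Relation.Unary using (Pred; Decidable)
open import Relation.Binary.PropositionalEquality hiding (J)

private variable
  k : ℕ
  x y z : Fin k
  p q : Subset k

⊈⇒∃∉ : p ⊈ q → ∃ λ x → x ∈ p × x ∉ q
⊈⇒∃∉ {p = []}         {[]}         p⊈q = contradiction (λ ()) p⊈q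
⊈⇒∃∉ {p = true ∷ p}  {false ∷ q}  _   = zero , here , λ ()
⊈⇒∃∉ {p = true ∷ p}  {true ∷ q}   p⊈q with ⊈⇒∃∉ (p⊈q ∘ in⊆in)
... | x , x∈p , x∉q = suc x , there x∈p , x∉q ∘ drop-there
⊈⇒∃∉ {p = false ∷ p} {b ∷ q}      p⊈q with ⊈⇒∃∉ (p⊈q ∘ out⊆)
... | x , x∈p , x∉q = suc x , there x∈p , x∉q ∘ drop-there

x∈p─q⁻ : ∀ (p q : Subset k) → x ∈ p ─ q → x ∈ p × x ∉ q
x∈p─q⁻ {x = zero}  (true ∷ p) (false ∷ q) here      = here , λ ()
x∈p─q⁻ {x = suc x} (_ ∷ p)    (_ ∷ q)     (there h) with x∈p─q⁻ p q h
... | x∈p , x∉q = there x∈p , x∉q ∘ drop-there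

x∈p-y⁻ : ∀ (p : Subset k) → x ∈ p - y → x ∈ p × x ≢ y
x∈p-y⁻ {y = y} p h with x∈p─q⁻ p ⁅ y ⁆ h
... | x∈p , x∉⁅y⁆ = x∈p , x∉⁅y⁆⇒x≢y x∉⁅y⁆

x∉p-x : ∀ (p : Subset k) → x ∉ p - x
x∉p-x p h = proj₂ (x∈p-y⁻ p h) refl

∣p∣≡∣p∩q∣+∣p─q∣ : ∀ (p q : Subset k) → ∣ p ∣ ≡ ∣ p ∩ q ∣ + ∣ p ─ q ∣
∣p∣≡∣p∩q∣+∣p─q∣ []          []          = refl
∣p∣≡∣p∩q∣+∣p─q∣ (true ∷ p)  (true ∷ q)  = cong suc (∣p∣≡∣p∩q∣+∣p─q∣ p q)
∣p∣≡∣p∩q∣+∣p─q∣ (true ∷ p)  (false ∷ q) =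
  trans (cong suc (∣p∣≡∣p∩q∣+∣p─q∣ p q)) (sym (ℕ.+-suc _ _))
∣p∣≡∣p∩q∣+∣p─q∣ (false ∷ p) (true ∷ q)  = ∣p∣≡∣p∩q∣+∣p─q∣ p q
∣p∣≡∣p∩q∣+∣p─q∣ (false ∷ p) (false ∷ q) = ∣p∣≡∣p∩q∣+∣p─q∣ p q

∣p∪q∣≤∣p∣+∣q∣ : ∀ (p q : Subset k) → ∣ p ∪ q ∣ ≤ ∣ p ∣ + ∣ q ∣
∣p∪q∣≤∣p∣+∣q∣ []          []          = z≤n
∣p∪q∣≤∣p∣+∣q∣ (true ∷ p)  (true ∷ q)  =
  s≤s (ℕ.≤-trans (∣p∪q∣≤∣p∣+∣q∣ p q) (ℕ.+-monoʳ-≤ ∣ p ∣ (ℕ.n≤1+n _)))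
∣p∪q∣≤∣p∣+∣q∣ (true ∷ p)  (false ∷ q) = s≤s (∣p∪q∣≤∣p∣+∣q∣ p q)
∣p∪q∣≤∣p∣+∣q∣ (false ∷ p) (true ∷ q)  =
  subst (suc ∣ p ∪ q ∣ ≤_) (sym (ℕ.+-suc _ _)) (s≤s (∣p∪q∣≤∣p∣+∣q∣ p q))
∣p∪q∣≤∣p∣+∣q∣ (false ∷ p) (false ∷ q) = ∣p∪q∣≤∣p∣+∣q∣ p q

0<∣p∣⇒Nonempty : ∀ (p : Subset k) → 0 < ∣ p ∣ → Nonempty p
0<∣p∣⇒Nonempty (true ∷ p)  _ = zero , here
0<∣p∣⇒Nonempty (false ∷ p) h with 0<∣p∣⇒Nonempty p h
... | x , x∈p = suc x , there x∈p

x∈p⇒⁅x⁆⊆p : x ∈ p → ⁅ x ⁆ ⊆ p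
x∈p⇒⁅x⁆⊆p {x = x} x∈p y∈⁅x⁆ = subst (_∈ _) (sym (x∈⁅y⁆⇒x≡y x y∈⁅x⁆)) x∈p

x∈p⇒1≤∣p∣ : x ∈ p → 1 ≤ ∣ p ∣
x∈p⇒1≤∣p∣ {x = x} x∈p = subst (_≤ _) (∣⁅x⁆∣≡1 x) (p⊆q⇒∣p∣≤∣q∣ (x∈p⇒⁅x⁆⊆p x∈p))

∣⁅x⁆∪p∣≡1+∣p∣ : ∀ (p : Subset k) → x ∉ p → ∣ ⁅ x ⁆ ∪ p ∣ ≡ suc ∣ p ∣
∣⁅x⁆∪p∣≡1+∣p∣ {x = x} p x∉p = ℕ.≤-antisym upper (p⊂q⇒∣p∣<∣q∣ p⊂⁅x⁆∪p)
  where
  upper : ∣ ⁅ x ⁆ ∪ p ∣ ≤ suc ∣ p ∣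
  upper = subst (λ n → ∣ ⁅ x ⁆ ∪ p ∣ ≤ n + ∣ p ∣) (∣⁅x⁆∣≡1 x) (∣p∪q∣≤∣p∣+∣q∣ ⁅ x ⁆ p)
  p⊂⁅x⁆∪p : p ⊂ ⁅ x ⁆ ∪ p
  p⊂⁅x⁆∪p = q⊆p∪q ⁅ x ⁆ p , x , x∈p∪q⁺ (inj₁ (x∈⁅x⁆ x)) , x∉p

∣⁅x⁆∪⁅y⁆∣≡2 : x ≢ y → ∣ ⁅ x ⁆ ∪ ⁅ y ⁆ ∣ ≡ 2
∣⁅x⁆∪⁅y⁆∣≡2 {y = y} x≢y =
  trans (∣⁅x⁆∪p∣≡1+∣p∣ ⁅ y ⁆ (x≢y⇒x∉⁅y⁆ x≢y)) (cong suc (∣⁅x⁆∣≡1 y))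

∣⁅x⁆∪⁅y⁆∪⁅z⁆∣≡3 : x ≢ y → x ≢ z → y ≢ z → ∣ ⁅ x ⁆ ∪ ⁅ y ⁆ ∪ ⁅ z ⁆ ∣ ≡ 3
∣⁅x⁆∪⁅y⁆∪⁅z⁆∣≡3 {x = x} {y} {z} x≢y x≢z y≢z =
  trans (∣⁅x⁆∪p∣≡1+∣p∣ (⁅ y ⁆ ∪ ⁅ z ⁆) x∉) (cong suc (∣⁅x⁆∪⁅y⁆∣≡2 y≢z))
  where
  x∉ : x ∉ ⁅ y ⁆ ∪ ⁅ z ⁆
  x∉ h with x∈p∪q⁻ ⁅ y ⁆ ⁅ z ⁆ h
  ... | inj₁ x∈⁅y⁆ = x≢y (x∈⁅y⁆⇒x≡y y x∈⁅y⁆)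
  ... | inj₂ x∈⁅z⁆ = x≢z (x∈⁅y⁆⇒x≡y z x∈⁅z⁆)

x≢y⇒2≤∣p∣ : x ≢ y → x ∈ p → y ∈ p → 2 ≤ ∣ p ∣
x≢y⇒2≤∣p∣ {x = x} {y} {p} x≢y x∈p y∈p =
  subst (_≤ ∣ p ∣) (∣⁅x⁆∪⁅y⁆∣≡2 x≢y) (p⊆q⇒∣p∣≤∣q∣ ⁅x⁆∪⁅y⁆⊆p)
  where
  ⁅x⁆∪⁅y⁆⊆p : ⁅ x ⁆ ∪ ⁅ y ⁆ ⊆ p
  ⁅x⁆∪⁅y⁆⊆p z∈ with x∈p∪q⁻ ⁅ x ⁆ ⁅ y ⁆ z∈
  ... | inj₁ z∈⁅x⁆ = x∈p⇒⁅x⁆⊆p x∈p z∈⁅x⁆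
  ... | inj₂ z∈⁅y⁆ = x∈p⇒⁅x⁆⊆p y∈p z∈⁅y⁆

p⊆⁅x⁆∪⁅y⁆⇒∣p∣≤2 : p ⊆ ⁅ x ⁆ ∪ ⁅ y ⁆ → ∣ p ∣ ≤ 2
p⊆⁅x⁆∪⁅y⁆⇒∣p∣≤2 {x = x} {y} p⊆ = ℕ.≤-trans (p⊆q⇒∣p∣≤∣q∣ p⊆)
  (subst₂ (λ a b → ∣ ⁅ x ⁆ ∪ ⁅ y ⁆ ∣ ≤ a + b) (∣⁅x⁆∣≡1 x) (∣⁅x⁆∣≡1 y) (∣p∪q∣≤∣p∣+∣q∣ ⁅ x ⁆ ⁅ y ⁆))

∀∈⇒≡⊤ : (∀ x → x ∈ p) → p ≡ ⊤
∀∈⇒≡⊤ h = ⊆-antisym ⊆⊤ (λ {x} _ → h x)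

≡⊤⇒∈ : p ≡ ⊤ → x ∈ p
≡⊤⇒∈ refl = ∈⊤

n≤∣p∣⇒p≡⊤ : ∀ (p : Subset k) → k ≤ ∣ p ∣ → p ≡ ⊤
n≤∣p∣⇒p≡⊤ p h = ∣p∣≡n⇒p≡⊤ (ℕ.≤-antisym (∣p∣≤n p) h)

∣p∣<n⇒∃∉ : ∀ (p : Subset k) → ∣ p ∣ < k → ∃ λ x → x ∉ p
∣p∣<n⇒∃∉ {k} p ∣p∣<k = let (x , _ , x∉p) = ⊈⇒∃∉ ⊤⊈p in x , x∉p
  where
  ⊤⊈p : ⊤ ⊈ p
  ⊤⊈p ⊤⊆p = ℕ.<⇒≱ ∣p∣<k (subst (_≤ ∣ p ∣) (∣⊤∣≡n k) (p⊆q⇒∣p∣≤∣q∣ ⊤⊆p))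

2≤n⇒∃≢ : 2 ≤ k → ∃₂ λ (x y : Fin k) → x ≢ y
2≤n⇒∃≢ {k} 2≤k with ∣p∣<n⇒∃∉ ⊥ (subst (_< k) (sym (∣⊥∣≡0 k)) (ℕ.≤-trans (s≤s z≤n) 2≤k))
... | x , _ with ∣p∣<n⇒∃∉ ⁅ x ⁆ (subst (_< k) (sym (∣⁅x⁆∣≡1 x)) 2≤k)
...   | y , y∉⁅x⁆ = x , y , λ x≡y → y∉⁅x⁆ (subst (_∈ ⁅ x ⁆) x≡y (x∈⁅x⁆ x))

x∈⁅a⁆∪⁅b⁆∪⁅c⁆⁻ : ∀ {a b c : Fin k} → x ∈ ⁅ a ⁆ ∪ ⁅ b ⁆ ∪ ⁅ c ⁆ → x ≡ a ⊎ x ≡ b ⊎ x ≡ c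
x∈⁅a⁆∪⁅b⁆∪⁅c⁆⁻ {a = a} {b} {c} h with x∈p∪q⁻ ⁅ a ⁆ _ h
... | inj₁ x∈⁅a⁆ = inj₁ (x∈⁅y⁆⇒x≡y a x∈⁅a⁆)
... | inj₂ x∈⁅b⁆∪⁅c⁆ with x∈p∪q⁻ ⁅ b ⁆ ⁅ c ⁆ x∈⁅b⁆∪⁅c⁆
...   | inj₁ x∈⁅b⁆ = inj₂ (inj₁ (x∈⁅y⁆⇒x≡y b x∈⁅b⁆))
...   | inj₂ x∈⁅c⁆ = inj₂ (inj₂ (x∈⁅y⁆⇒x≡y c x∈⁅c⁆))

Fin3-cover : ∀ {a b c : Fin 3} → a ≢ b → a ≢ c → b ≢ c → ∀ d → d ≡ a ⊎ d ≡ b ⊎ d ≡ c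
Fin3-cover {a} {b} {c} a≢b a≢c b≢c d = x∈⁅a⁆∪⁅b⁆∪⁅c⁆⁻ (≡⊤⇒∈ {x = d} abc≡⊤)
  where
  abc≡⊤ : ⁅ a ⁆ ∪ ⁅ b ⁆ ∪ ⁅ c ⁆ ≡ ⊤
  abc≡⊤ = n≤∣p∣⇒p≡⊤ _ (ℕ.≤-reflexive (sym (∣⁅x⁆∪⁅y⁆∪⁅z⁆∣≡3 a≢b a≢c b≢c)))

∈-allSubsets : ∀ (S : Subset k) → S ∈ₗ allSubsets k
∈-allSubsets []          = Any.here refl
∈-allSubsets (true ∷ S)  = List.∈-++⁺ˡ (List.∈-map⁺ (true ∷_) (∈-allSubsets S))
∈-allSubsets {suc k} (false ∷ S) =
  List.∈-++⁺ʳ (map (true ∷_) (allSubsets k)) (List.∈-map⁺ (false ∷_) (∈-allSubsets S))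

≤-maximum : ∀ {x} xs → x ∈ₗ xs → x ≤ maximum xs
≤-maximum (y ∷ xs) (Any.here refl) = ℕ.m≤m⊔n y (maximum xs)
≤-maximum (y ∷ xs) (Any.there x∈xs) = ℕ.m≤n⇒m≤o⊔n y (≤-maximum xs x∈xs)

maximum-sel : ∀ xs → maximum xs ≡ 0 ⊎ maximum xs ∈ₗ xs
maximum-sel = List.foldr-selective ℕ.⊔-sel 0

T-foldr-not∧ : ∀ {a ℓ} {A : Set a} {P : Pred A ℓ} (P? : Decidable P) (xs : List A) →
               T (foldr (λ x acc → not ⌊ P? x ⌋ ∧ acc) true xs) ⇔ All (¬_ ∘ P) xs
T-foldr-not∧ P? []       = mk⇔ (λ _ → All.[]) (λ _ → _)
T-foldr-not∧ P? (x ∷ xs) with P? x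
... | yes px = mk⇔ (λ ()) (λ { (¬px All.∷ _) → ¬px px })
... | no ¬px = mk⇔ (λ t → ¬px All.∷ Equivalence.to (T-foldr-not∧ P? xs) t)
                   (λ { (_ All.∷ all) → Equivalence.from (T-foldr-not∧ P? xs) all })

module _ (M : Matroid) where

  private
    E : ℕ
    E = n M
    C : Fin (m M) → Subset E
    C = circ M

    independentIn : Subset E → Subset E → Bool
    independentIn S I = ⌊ I ⊆? S ⌋ ∧ circuitFree? M I

  Independent : Subset E → Set
  Independent I = ∀ i → C i ⊈ I

  T-circuitFree? : ∀ {I} → T (circuitFree? M I) ⇔ Independent I
  T-circuitFree? {I} = mk⇔
    (λ t i → All.lookup (Equivalence.to all⇔ t) (List.∈-allFin i))
    (λ ind → Equivalence.from all⇔ (All.tabulate (λ {i} _ → ind i)))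
    where
    all⇔ : T (circuitFree? M I) ⇔ All (λ i → C i ⊈ I) (allFin (m M))
    all⇔ = T-foldr-not∧ (λ i → C i ⊆? I) (allFin (m M))

  ¬Independent⇒∃⊆ : ∀ {S} → ¬ Independent S → ∃ λ i → C i ⊆ S
  ¬Independent⇒∃⊆ {S} ¬ind with Fin.any? (λ i → C i ⊆? S)
  ... | yes found = found
  ... | no ¬found = ⊥-elim (¬ind λ i Ci⊆S → ¬found (i , Ci⊆S))

  Independent-antimono : ∀ {I J} → J ⊆ I → Independent I → Independent J
  Independent-antimono J⊆I ind i Ci⊆J = ind i (⊆-trans Ci⊆J J⊆I)

  ⊥-Independent : Independent ⊥
  ⊥-Independent i Ci⊆⊥ = ∉⊥ (Ci⊆⊥ (proj₂ (nonempty M i)))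

  rank-≥ : ∀ {S J} → J ⊆ S → Independent J → ∣ J ∣ ≤ rank M S
  rank-≥ {S} {J} J⊆S ind =
    ≤-maximum _ (List.∈-map⁺ ∣_∣ (List.∈-filter⁺ (T? ∘ independentIn S) (∈-allSubsets J) J-ok))
    where
    J-ok : T (independentIn S J)
    J-ok = Equivalence.from Bool.T-∧
      (fromWitness (λ {x} → J⊆S) , Equivalence.from T-circuitFree? ind)

  rank-attained : ∀ S → ∃ λ J → J ⊆ S × Independent J × rank M S ≡ ∣ J ∣
  rank-attained S with maximum-sel (map ∣_∣ (filterᵇ (independentIn S) (allSubsets E)))
  ... | inj₁ rank≡0 = ⊥ , ⊥⊆ , ⊥-Independent , trans rank≡0 (sym (∣⊥∣≡0 E))
  ... | inj₂ rank∈ with List.∈-map⁻ ∣_∣ rank∈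
  ...   | J , J∈ , rank≡∣J∣
        with List.∈-filter⁻ (T? ∘ independentIn S) {xs = allSubsets E} J∈
  ...     | _ , J-ok with Equivalence.to (Bool.T-∧ {⌊ J ⊆? S ⌋}) J-ok
  ...       | J⊆S , cf = J , toWitness J⊆S , Equivalence.to T-circuitFree? cf , rank≡∣J∣

  nullity≤∣S─J∣ : ∀ S {J} → Independent J → nullity M S ≤ ∣ S ─ J ∣
  nullity≤∣S─J∣ S {J} ind =
    subst (nullity M S ≤_) ∣S∣∸∣S∩J∣≡∣S─J∣ (ℕ.∸-monoʳ-≤ ∣ S ∣ ∣S∩J∣≤rank)
    where
    ∣S∩J∣≤rank : ∣ S ∩ J ∣ ≤ rank M S
    ∣S∩J∣≤rank = rank-≥ (p∩q⊆p S J) (Independent-antimono (p∩q⊆q S J) ind)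
    ∣S∣∸∣S∩J∣≡∣S─J∣ : ∣ S ∣ ∸ ∣ S ∩ J ∣ ≡ ∣ S ─ J ∣
    ∣S∣∸∣S∩J∣≡∣S─J∣ =
      trans (cong (_∸ ∣ S ∩ J ∣) (∣p∣≡∣p∩q∣+∣p─q∣ S J)) (ℕ.m+n∸m≡n ∣ S ∩ J ∣ ∣ S ─ J ∣)

  nullity-≥ : ∀ S {t} → (∀ J → J ⊆ S → Independent J → t ≤ ∣ S ─ J ∣) → t ≤ nullity M S
  nullity-≥ S {t} bound with rank-attained S
  ... | J , J⊆S , ind , rank≡∣J∣ = subst (t ≤_) (sym nullity≡∣S─J∣) (bound J J⊆S ind)
    where
    open ≡-Reasoning
    S∩J≡J : S ∩ J ≡ J
    S∩J≡J = ⊆-antisym (p∩q⊆q S J) (λ x∈J → x∈p∩q⁺ (J⊆S x∈J , x∈J))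
    nullity≡∣S─J∣ : nullity M S ≡ ∣ S ─ J ∣
    nullity≡∣S─J∣ = begin
      ∣ S ∣ ∸ rank M S              ≡⟨ cong (∣ S ∣ ∸_) rank≡∣J∣ ⟩
      ∣ S ∣ ∸ ∣ J ∣                 ≡⟨ cong (_∸ ∣ J ∣) (∣p∣≡∣p∩q∣+∣p─q∣ S J) ⟩
      ∣ S ∩ J ∣ + ∣ S ─ J ∣ ∸ ∣ J ∣ ≡⟨ cong (λ X → ∣ X ∣ + ∣ S ─ J ∣ ∸ ∣ J ∣) S∩J≡J ⟩
      ∣ J ∣ + ∣ S ─ J ∣ ∸ ∣ J ∣     ≡⟨ ℕ.m+n∸m≡n ∣ J ∣ _ ⟩
      ∣ S ─ J ∣                     ∎

  circuit⊆⇒1≤nullity : ∀ {i S} → C i ⊆ S → 1 ≤ nullity M S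
  circuit⊆⇒1≤nullity {i} {S} Ci⊆S = nullity-≥ S λ J _ ind →
    let (x , x∈Ci , x∉J) = ⊈⇒∃∉ (ind i) in x∈p⇒1≤∣p∣ (x∈p∧x∉q⇒x∈p─q (Ci⊆S x∈Ci) x∉J)

  private
    addIf : Subset (m M) → Fin (m M) → Subset E → Subset E
    addIf A i acc = if lookup A i then C i ∪ acc else acc

    ∈foldr-addIf⁻ : ∀ {A x} is → x ∈ foldr (addIf A) ⊥ is → ∃ λ i → i ∈ A × x ∈ C i
    ∈foldr-addIf⁻ []                h = ⊥-elim (∉⊥ h)
    ∈foldr-addIf⁻ {A} {x} (i ∷ is) h with lookup A i in Ai
    ... | false = ∈foldr-addIf⁻ is h
    ... | true with x∈p∪q⁻ (C i) _ h
    ...   | inj₁ x∈Ci = i , Vec.lookup⇒[]= i A Ai , x∈Ci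
    ...   | inj₂ x∈rest = ∈foldr-addIf⁻ is x∈rest

    ∈foldr-addIf⁺ : ∀ {A x i} is → i ∈ₗ is → i ∈ A → x ∈ C i → x ∈ foldr (addIf A) ⊥ is
    ∈foldr-addIf⁺ {A} (j ∷ is) i∈ i∈A x∈Ci with lookup A j in Aj | i∈
    ... | true  | Any.here refl = x∈p∪q⁺ (inj₁ x∈Ci)
    ... | true  | Any.there i∈is = x∈p∪q⁺ (inj₂ (∈foldr-addIf⁺ is i∈is i∈A x∈Ci))
    ... | false | Any.here refl = contradiction (trans (sym (Vec.[]=⇒lookup i∈A)) Aj) λ ()
    ... | false | Any.there i∈is = ∈foldr-addIf⁺ is i∈is i∈A x∈Ci

  x∈unionOf⁻ : ∀ {A x} → x ∈ unionOf M A → ∃ λ i → i ∈ A × x ∈ C i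
  x∈unionOf⁻ = ∈foldr-addIf⁻ (allFin (m M))

  circ⊆unionOf : ∀ {A i} → i ∈ A → C i ⊆ unionOf M A
  circ⊆unionOf {i = i} i∈A = ∈foldr-addIf⁺ (allFin (m M)) (List.∈-allFin i) i∈A

  elimination-third : ∀ {i j z} → i ≢ j → z ∈ C i → z ∈ C j →
                      ∃ λ g → g ≢ i × g ≢ j × C g ⊆ (C i ∪ C j) - z
  elimination-third {i} {j} {z} i≢j z∈Ci z∈Cj with elimination M i j i≢j z z∈Ci z∈Cj
  ... | g , Cg⊆ = g , (λ { refl → ∉Cg z∈Ci }) , (λ { refl → ∉Cg z∈Cj }) , Cg⊆
    where
    ∉Cg : z ∉ C g
    ∉Cg z∈Cg = x∉p-x _ (Cg⊆ z∈Cg)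

  module _ (conn : Connected M) where

    private
      common : ∀ e f → e ≢ f → ∃ λ i → e ∈ C i × f ∈ C i
      common = proj₂ conn

    connected⇒covered : Fin (m M) → ∀ x → ∃ λ i → x ∈ C i
    connected⇒covered i x with nonempty M i
    ... | e , e∈Ci with x ≟ e
    ...   | yes refl = i , e∈Ci
    ...   | no x≢e = let (g , x∈Cg , _) = common x e x≢e in g , x∈Cg

    connected∧¬circuit⇒subsingleton : ¬ Fin (m M) → ∀ (x y : Fin E) → x ≡ y
    connected∧¬circuit⇒subsingleton ¬circuit x y with x ≟ y
    ... | yes x≡y = x≡y
    ... | no x≢y = ⊥-elim (¬circuit (proj₁ (common x y x≢y)))

    connected⇒bridge : ∀ {i j} → Empty (C i ∩ C j) →
      ∃ λ g → g ≢ i × g ≢ j × Nonempty (C g ∩ C i) × Nonempty (C g ∩ C j)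
    connected⇒bridge {i} {j} disjoint with nonempty M i | nonempty M j
    ... | e , e∈Ci | f , f∈Cj with common e f (λ { refl → disjoint (e , x∈p∩q⁺ (e∈Ci , f∈Cj)) })
    ...   | g , e∈Cg , f∈Cg =
      g , (λ { refl → disjoint (f , x∈p∩q⁺ (f∈Cg , f∈Cj)) })
        , (λ { refl → disjoint (e , x∈p∩q⁺ (e∈Ci , e∈Cg)) })
        , (e , x∈p∩q⁺ (e∈Cg , e∈Ci))
        , (f , x∈p∩q⁺ (f∈Cg , f∈Cj))

    connected⇒meeting-pair : 2 ≤ m M → ∃₂ λ P Q → P ≢ Q × Nonempty (C P ∩ C Q)
    connected⇒meeting-pair 2≤m with 2≤n⇒∃≢ 2≤m
    ... | i , j , i≢j with nonempty? (C i ∩ C j)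
    ...   | yes meet = i , j , i≢j , meet
    ...   | no disjoint =
      let (g , g≢i , _ , meet , _) = connected⇒bridge disjoint in g , i , g≢i , meet

    connected⇒3≤m : 2 ≤ m M → 3 ≤ m M
    connected⇒3≤m 2≤m with connected⇒meeting-pair 2≤m
    ... | P , Q , P≢Q , z , z∈CP∩CQ with x∈p∩q⁻ (C P) (C Q) z∈CP∩CQ
    ...   | z∈CP , z∈CQ with elimination-third P≢Q z∈CP z∈CQ
    ...     | g , g≢P , g≢Q , _ =
      subst (_≤ m M) (∣⁅x⁆∪⁅y⁆∪⁅z⁆∣≡3 P≢Q (g≢P ∘ sym) (g≢Q ∘ sym)) (∣p∣≤n (⁅ P ⁆ ∪ ⁅ Q ⁆ ∪ ⁅ g ⁆))

module _ (M : Matroid) (P : Subset (m M) → Set)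
         (step : ∀ {𝒳 : Subset (m M) → Set} → (∀ {A} → 𝒳 A → P A) → ∀ {A} → ↑ (ε 𝒳) A → P A)
         (base : ∀ {A} → 𝒜 M 0 A → P A) where

  𝒜-induction : ∀ i {A} → 𝒜 M i A → P A
  𝒜-induction zero    = base
  𝒜-induction (suc i) = step (𝒜-induction i)

  δ-induction : ∀ {A} → Dep (δ M) A → P A
  δ-induction (i , A∈𝒜ᵢ) = 𝒜-induction i A∈𝒜ᵢ

module _ {k} {𝒳 : Subset k → Set} where

  ↑ε-empty : (∀ {A} → 𝒳 A → False) → ∀ {A} → ↑ (ε 𝒳) A → False
  ↑ε-empty none (_ , inj₁ A′∈𝒳 , _)                 = none A′∈𝒳
  ↑ε-empty none (_ , inj₂ (_ , _ , A₁∈𝒳 , _) , _) = none A₁∈𝒳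

  ↑ε-⊤ : (∀ {A} → 𝒳 A → A ≡ ⊤) → ∀ {A} → ↑ (ε 𝒳) A → A ≡ ⊤
  ↑ε-⊤ only⊤ (_ , inj₁ A′∈𝒳 , A′⊆A) with only⊤ A′∈𝒳
  ... | refl = ⊆-antisym ⊆⊤ A′⊆A
  ↑ε-⊤ only⊤ (_ , inj₂ (_ , _ , A₁∈𝒳 , A₂∈𝒳 , A₁∩A₂∉𝒳 , _) , _) with only⊤ A₁∈𝒳 | only⊤ A₂∈𝒳
  ... | refl | refl = ⊥-elim (A₁∩A₂∉𝒳 (subst 𝒳 (sym (∩-idem ⊤)) A₁∈𝒳))

subsingleton⇒δ-free : (M : Matroid) → (∀ (i j : Fin (m M)) → i ≡ j) → ∀ A → ¬ Dep (δ M) A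
subsingleton⇒δ-free M all≡ A = δ-induction M (λ _ → False) ↑ε-empty (λ {A} → 𝒜₀-empty {A}) {A}
  where
  𝒜₀-empty : ∀ {A} → ¬ 𝒜 M 0 A
  𝒜₀-empty {A} A∈𝒜₀ with 0<∣p∣⇒Nonempty A (ℕ.≤-trans (s≤s z≤n) A∈𝒜₀)
  ... | j , j∈A = ℕ.<⇒≱ (ℕ.≤-trans (s≤s 1≤nullity) A∈𝒜₀) ∣A∣≤1
    where
    1≤nullity : 1 ≤ nullity M (unionOf M A)
    1≤nullity = circuit⊆⇒1≤nullity M (circ⊆unionOf M j∈A)
    ∣A∣≤1 : ∣ A ∣ ≤ 1
    ∣A∣≤1 = subst (∣ A ∣ ≤_) (∣⁅x⁆∣≡1 j)
      (p⊆q⇒∣p∣≤∣q∣ {p = A} λ {i} _ → subst (_∈ ⁅ j ⁆) (all≡ j i) (x∈⁅x⁆ j))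

image-id : ∀ {a} (A : Subset a) → image (↔-id (Fin a)) A ≡ A
image-id = Vec.tabulate∘lookup

image≡⊤⇔≡⊤ : ∀ {a b} (φ : Fin a ↔ Fin b) (A : Subset a) → image φ A ≡ ⊤ ⇔ A ≡ ⊤
image≡⊤⇔≡⊤ φ A = mk⇔ to from
  where
  open Inverse φ using (strictlyInverseʳ) renaming (to to φ⁺; from to φ⁻)
  to : image φ A ≡ ⊤ → A ≡ ⊤
  to image≡⊤ = ∀∈⇒≡⊤ λ x → Vec.lookup⇒[]= x A (begin
    lookup A x                           ≡⟨ cong (lookup A) (strictlyInverseʳ x) ⟨
    lookup A (φ⁻ (φ⁺ x))                 ≡⟨ Vec.lookup∘tabulate (lookup A ∘ φ⁻) (φ⁺ x) ⟨
    lookup (image φ A) (φ⁺ x)            ≡⟨ Vec.[]=⇒lookup (≡⊤⇒∈ image≡⊤) ⟩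
    true                                 ∎)
    where open ≡-Reasoning
  from : A ≡ ⊤ → image φ A ≡ ⊤
  from refl = ∀∈⇒≡⊤ λ y → Vec.lookup⇒[]= y _
    (trans (Vec.lookup∘tabulate _ y) (Vec.lookup-replicate (φ⁻ y) true))

≅-byIdentity : ∀ {k} {P Q : Subset k → Set} → (∀ A → P A ⇔ Q A) →
               record { size = k ; Dep = P } ≅ record { size = k ; Dep = Q }
≅-byIdentity {P = P} {Q} P⇔Q =
  ↔-id _ , λ A → subst (λ B → P A ⇔ Q B) (sym (image-id A)) (P⇔Q A)

≅-free : ∀ D₁ D₂ → Fin (size D₁) ↔ Fin (size D₂) →
         (∀ A → ¬ Dep D₁ A) → (∀ B → ¬ Dep D₂ B) → D₁ ≅ D₂
≅-free _ _ φ free₁ free₂ = φ , λ A → mk⇔ (⊥-elim ∘ free₁ A) (⊥-elim ∘ free₂ _)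

U[k,k]-free : ∀ k A → ¬ Dep (U k k) A
U[k,k]-free k A k<∣A∣ = ℕ.<⇒≱ k<∣A∣ (∣p∣≤n A)

Dep-U[k,1+k]⇔≡⊤ : ∀ {k} (A : Subset (suc k)) → Dep (U k (suc k)) A ⇔ A ≡ ⊤
Dep-U[k,1+k]⇔≡⊤ {k} A = mk⇔ (n≤∣p∣⇒p≡⊤ A) λ { refl → ℕ.≤-reflexive (sym (∣⊤∣≡n (suc k))) }

≅U[k,1+k]⇒Dep⇔≡⊤ : ∀ {D k} → D ≅ U k (suc k) → ∀ A → Dep D A ⇔ A ≡ ⊤
≅U[k,1+k]⇒Dep⇔≡⊤ (φ , Dep⇔) A =
  ⇔.trans (Dep⇔ A) (⇔.trans (Dep-U[k,1+k]⇔≡⊤ (image φ A)) (image≡⊤⇔≡⊤ φ A))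

↔Fin0 : ∀ {a} → ¬ Fin a → Fin a ↔ Fin 0
↔Fin0 ¬x = mk↔ₛ′ (⊥-elim ∘ ¬x) (λ ()) (λ ()) (⊥-elim ∘ ¬x)

↔Fin1 : ∀ {a} → Fin a → (∀ (x y : Fin a) → x ≡ y) → Fin a ↔ Fin 1
↔Fin1 x₀ all≡ = mk↔ₛ′ (λ _ → zero) (λ _ → x₀) (λ { zero → refl }) (all≡ x₀)

↔Fin1⇒subsingleton : ∀ {a} → Fin a ↔ Fin 1 → ∀ (x y : Fin a) → x ≡ y
↔Fin1⇒subsingleton φ x y = begin
  x             ≡⟨ strictlyInverseʳ x ⟨
  φ⁻ (φ⁺ x)     ≡⟨ cong φ⁻ (Fin1-irrelevant (φ⁺ x) (φ⁺ y)) ⟩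
  φ⁻ (φ⁺ y)     ≡⟨ strictlyInverseʳ y ⟩
  y             ∎
  where
  open ≡-Reasoning
  open Inverse φ using (strictlyInverseʳ) renaming (to to φ⁺; from to φ⁻)
  Fin1-irrelevant : ∀ (i j : Fin 1) → i ≡ j
  Fin1-irrelevant zero zero = refl

δ≅∅⇒≅U₁₁ : (M : Matroid) → Connected M → δ M ≅ emptyM → toDS M ≅ U 1 1
δ≅∅⇒≅U₁₁ M conn (φ , _) =
  ≅-free (toDS M) (U 1 1) (↔Fin1 (fromℕ< (proj₁ conn)) one-element) no-dep (U[k,k]-free 1)
  where
  no-circuit : ¬ Fin (m M)
  no-circuit = Fin.¬Fin0 ∘ Inverse.to φ
  one-element : ∀ (x y : Fin (n M)) → x ≡ y
  one-element = connected∧¬circuit⇒subsingleton M conn no-circuit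
  no-dep : ∀ S → ¬ Dep (toDS M) S
  no-dep _ (i , _) = no-circuit i

≅U₁₁⇒δ≅∅ : (M : Matroid) → toDS M ≅ U 1 1 → δ M ≅ emptyM
≅U₁₁⇒δ≅∅ M (φ , Dep⇔) =
  ≅-free (δ M) emptyM (↔Fin0 no-circuit) (subsingleton⇒δ-free M (⊥-elim ∘ no-circuit)) λ _ ()
  where
  no-circuit : ¬ Fin (m M)
  no-circuit i = U[k,k]-free 1 (image φ (circ M i)) (Equivalence.to (Dep⇔ (circ M i)) (i , id))

circuits≡⊤⇒Dep⇔≡⊤ : (M : Matroid) → Fin (m M) → (∀ i → circ M i ≡ ⊤) →
                    ∀ S → Dep (toDS M) S ⇔ S ≡ ⊤
circuits≡⊤⇒Dep⇔≡⊤ M i₀ all≡⊤ S = mk⇔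
  (λ { (i , Ci⊆S) → ⊆-antisym ⊆⊤ (subst (_⊆ S) (all≡⊤ i) Ci⊆S) })
  (λ { refl → i₀ , ⊆⊤ })

δ≅U₁₁⇒≅U[k,1+k] : (M : Matroid) → Connected M → δ M ≅ U 1 1 → ∃ λ k → toDS M ≅ U k (suc k)
δ≅U₁₁⇒≅U[k,1+k] M@record { n = zero }  (() , _) _
δ≅U₁₁⇒≅U[k,1+k] M@record { n = suc k } conn (φ , _) =
  k , ≅-byIdentity λ S → ⇔.trans (circuits≡⊤⇒Dep⇔≡⊤ M i₀ all≡⊤ S) (⇔.sym (Dep-U[k,1+k]⇔≡⊤ S))
  where
  i₀ : Fin (m M)
  i₀ = Inverse.from φ zero
  all≡⊤ : ∀ i → circ M i ≡ ⊤
  all≡⊤ i = ∀∈⇒≡⊤ λ x → let (g , x∈Cg) = connected⇒covered M conn i x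
                        in subst (λ j → x ∈ circ M j) (↔Fin1⇒subsingleton φ g i) x∈Cg

≅U[k,1+k]⇒δ≅U₁₁ : (M : Matroid) → ∀ k → toDS M ≅ U k (suc k) → δ M ≅ U 1 1
≅U[k,1+k]⇒δ≅U₁₁ M k iso =
  ≅-free (δ M) (U 1 1) (↔Fin1 i₀ all≡) (subsingleton⇒δ-free M all≡) (U[k,k]-free 1)
  where
  Dep⇔≡⊤ : ∀ S → Dep (toDS M) S ⇔ S ≡ ⊤
  Dep⇔≡⊤ = ≅U[k,1+k]⇒Dep⇔≡⊤ iso
  i₀ : Fin (m M)
  i₀ = proj₁ (Equivalence.from (Dep⇔≡⊤ ⊤) refl)
  all≡ : ∀ (i j : Fin (m M)) → i ≡ j
  all≡ i j = incomparable M i j (subst (circ M i ⊆_) (sym Cj≡⊤) ⊆⊤)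
    where
    Cj≡⊤ : circ M j ≡ ⊤
    Cj≡⊤ = Equivalence.to (Dep⇔≡⊤ (circ M j)) (j , id)

connected⇒Tricycle : (M : Matroid) → Connected M → m M ≡ 3 → Tricycle M
connected⇒Tricycle M@record { m = _ } conn refl =
  refl , (λ i j i≢j → meet i≢j , cover i≢j) , triple
  where
  C : Fin 3 → Subset (n M)
  C = circ M

  meet : ∀ {i j} → i ≢ j → Nonempty (C i ∩ C j)
  meet {i} {j} i≢j with nonempty? (C i ∩ C j)
  ... | yes meeting = meeting
  ... | no disjoint with connected⇒bridge M conn disjoint
  ...   | g , g≢i , g≢j , (e , e∈Cg∩Ci) , _
        with x∈p∩q⁻ (C g) (C i) e∈Cg∩Ci
  ...     | e∈Cg , e∈Ci with elimination-third M g≢i e∈Cg e∈Ci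
  ...       | h , h≢g , h≢i , Ch⊆ with Fin3-cover i≢j (g≢i ∘ sym) (g≢j ∘ sym) h
  ...         | inj₁ refl        = ⊥-elim (h≢i refl)
  ...         | inj₂ (inj₂ refl) = ⊥-elim (h≢g refl)
  ...         | inj₂ (inj₁ refl) = ⊥-elim (g≢j (sym (incomparable M h g Ch⊆Cg)))
    where
    Ch⊆Cg : C h ⊆ C g
    Ch⊆Cg {y} y∈Ch with x∈p∪q⁻ (C g) (C i) (proj₁ (x∈p-y⁻ _ (Ch⊆ y∈Ch)))
    ... | inj₁ y∈Cg = y∈Cg
    ... | inj₂ y∈Ci = ⊥-elim (disjoint (y , x∈p∩q⁺ (y∈Ci , y∈Ch)))

  cover : ∀ {i j} → i ≢ j → C i ∪ C j ≡ ⊤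
  cover {i} {j} i≢j with meet i≢j
  ... | z , z∈Ci∩Cj with x∈p∩q⁻ (C i) (C j) z∈Ci∩Cj
  ...   | z∈Ci , z∈Cj with elimination-third M i≢j z∈Ci z∈Cj
  ...     | h , h≢i , h≢j , Ch⊆ = ∀∈⇒≡⊤ λ x → covered x (connected⇒covered M conn i x)
    where
    covered : ∀ x → ∃ (λ g → x ∈ C g) → x ∈ C i ∪ C j
    covered x (g , x∈Cg) with Fin3-cover i≢j (h≢i ∘ sym) (h≢j ∘ sym) g
    ... | inj₁ refl        = x∈p∪q⁺ (inj₁ x∈Cg)
    ... | inj₂ (inj₁ refl) = x∈p∪q⁺ (inj₂ x∈Cg)
    ... | inj₂ (inj₂ refl) = proj₁ (x∈p-y⁻ _ (Ch⊆ x∈Cg))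

  triple : ∀ i j k → i ≢ j → j ≢ k → i ≢ k → C i ∩ C j ∩ C k ≡ ⊥
  triple i j k i≢j j≢k i≢k = Empty-unique λ (z , z∈Ci∩Cj∩Ck) → no-common z z∈Ci∩Cj∩Ck
    where
    no-common : ∀ z → z ∉ C i ∩ C j ∩ C k
    no-common z z∈ with x∈p∩q⁻ (C i) _ z∈
    ... | z∈Ci , z∈Cj∩Ck with x∈p∩q⁻ (C j) (C k) z∈Cj∩Ck
    ...   | z∈Cj , z∈Ck with elimination-third M i≢j z∈Ci z∈Cj
    ...     | h , h≢i , h≢j , Ch⊆ with Fin3-cover i≢j i≢k j≢k h
    ...       | inj₁ refl        = h≢i refl
    ...       | inj₂ (inj₁ refl) = h≢j refl
    ...       | inj₂ (inj₂ refl) = x∉p-x _ (Ch⊆ z∈Ck)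

Tricycle⇒δ≅U₂₃ : (M : Matroid) → Tricycle M → δ M ≅ U 2 3
Tricycle⇒δ≅U₂₃ M@record { m = _ } (refl , pairwise , triple) =
  ≅-byIdentity λ A → ⇔.trans (Dep⇔≡⊤ A) (⇔.sym (Dep-U[k,1+k]⇔≡⊤ A))
  where
  C : Fin 3 → Subset (n M)
  C = circ M

  outside-pair : ∀ {J x} → Independent M J → ∀ j → x ∉ J → x ∉ C j →
                 ∃₂ λ x y → x ≢ y × x ∉ J × y ∉ J
  outside-pair {x = x} ind j x∉J x∉Cj with ⊈⇒∃∉ (ind j)
  ... | y , y∈Cj , y∉J = x , y , (λ { refl → x∉Cj y∈Cj }) , x∉J , y∉J

  two-outside : ∀ {J} → Independent M J → ∃₂ λ x y → x ≢ y × x ∉ J × y ∉ J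
  two-outside ind with ⊈⇒∃∉ (ind 0F)
  ... | x , x∈C₀ , x∉J with x ∈? C 1F
  ...   | no x∉C₁  = outside-pair ind 1F x∉J x∉C₁
  ...   | yes x∈C₁ = outside-pair ind 2F x∉J λ x∈C₂ →
    ∉⊥ (subst (x ∈_) (triple 0F 1F 2F (λ ()) (λ ()) (λ ()))
                     (x∈p∩q⁺ (x∈C₀ , x∈p∩q⁺ (x∈C₁ , x∈C₂))))

  2≤nullity : ∀ {A i j} → i ≢ j → i ∈ A → j ∈ A → 2 ≤ nullity M (unionOf M A)
  2≤nullity {A} {i} {j} i≢j i∈A j∈A = nullity-≥ M _ λ J _ ind →
    let (x , y , x≢y , x∉J , y∉J) = two-outside ind in
    x≢y⇒2≤∣p∣ x≢y (x∈p∧x∉q⇒x∈p─q (everywhere x) x∉J) (x∈p∧x∉q⇒x∈p─q (everywhere y) y∉J)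
    where
    everywhere : ∀ x → x ∈ unionOf M A
    everywhere x with x∈p∪q⁻ (C i) (C j) (≡⊤⇒∈ (proj₂ (pairwise i j i≢j)))
    ... | inj₁ x∈Ci = circ⊆unionOf M i∈A x∈Ci
    ... | inj₂ x∈Cj = circ⊆unionOf M j∈A x∈Cj

  𝒜₀-⊤ : 𝒜 M 0 ⊤
  𝒜₀-⊤ with proj₁ (pairwise 0F 1F (λ ())) | proj₁ (pairwise 0F 2F (λ ()))
  ... | x , x∈C₀∩C₁ | y , y∈C₀∩C₂ =
    s≤s (ℕ.≤-trans (nullity≤∣S─J∣ M _ J-independent) (p⊆⁅x⁆∪⁅y⁆⇒∣p∣≤2 outside⊆))
    where
    J : Subset (n M)
    J = ∁ (⁅ x ⁆ ∪ ⁅ y ⁆)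
    x∉J : x ∉ J
    x∉J = x∈p⇒x∉∁p (x∈p∪q⁺ (inj₁ (x∈⁅x⁆ x)))
    y∉J : y ∉ J
    y∉J = x∈p⇒x∉∁p (x∈p∪q⁺ (inj₂ (x∈⁅x⁆ y)))
    J-independent : Independent M J
    J-independent 0F C₀⊆J = x∉J (C₀⊆J (proj₁ (x∈p∩q⁻ _ _ x∈C₀∩C₁)))
    J-independent 1F C₁⊆J = x∉J (C₁⊆J (proj₂ (x∈p∩q⁻ _ _ x∈C₀∩C₁)))
    J-independent 2F C₂⊆J = y∉J (C₂⊆J (proj₂ (x∈p∩q⁻ _ _ y∈C₀∩C₂)))
    outside⊆ : unionOf M ⊤ ─ J ⊆ ⁅ x ⁆ ∪ ⁅ y ⁆
    outside⊆ z∈ = x∉∁p⇒x∈p (proj₂ (x∈p─q⁻ _ J z∈))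

  1≤nullity : ∀ {A i} → i ∈ A → 1 ≤ nullity M (unionOf M A)
  1≤nullity {A} i∈A = circuit⊆⇒1≤nullity M (circ⊆unionOf M {A} i∈A)

  𝒜₀⇒≡⊤ : ∀ A → 𝒜 M 0 A → A ≡ ⊤
  𝒜₀⇒≡⊤ (true  ∷ true  ∷ true  ∷ []) _ = refl
  𝒜₀⇒≡⊤ (false ∷ false ∷ false ∷ []) ()
  𝒜₀⇒≡⊤ A@(true  ∷ false ∷ false ∷ []) a = ⊥-elim (ℕ.<⇒≱ a (1≤nullity {A} here))
  𝒜₀⇒≡⊤ A@(false ∷ true  ∷ false ∷ []) a = ⊥-elim (ℕ.<⇒≱ a (1≤nullity {A} (there here)))
  𝒜₀⇒≡⊤ A@(false ∷ false ∷ true  ∷ []) a = ⊥-elim (ℕ.<⇒≱ a (1≤nullity {A} (there (there here))))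
  𝒜₀⇒≡⊤ A@(true  ∷ true  ∷ false ∷ []) a =
    ⊥-elim (ℕ.<⇒≱ a (2≤nullity {A} (λ ()) here (there here)))
  𝒜₀⇒≡⊤ A@(true  ∷ false ∷ true  ∷ []) a =
    ⊥-elim (ℕ.<⇒≱ a (2≤nullity {A} (λ ()) here (there (there here))))
  𝒜₀⇒≡⊤ A@(false ∷ true  ∷ true  ∷ []) a =
    ⊥-elim (ℕ.<⇒≱ a (2≤nullity {A} (λ ()) (there here) (there (there here))))

  Dep⇔≡⊤ : ∀ A → Dep (δ M) A ⇔ A ≡ ⊤
  Dep⇔≡⊤ A = mk⇔ (δ-induction M (_≡ ⊤) ↑ε-⊤ (λ {A} → 𝒜₀⇒≡⊤ A)) λ { refl → 0 , 𝒜₀-⊤ }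

IsBasis : (M : Matroid) → Subset (n M) → Set
IsBasis M I = Independent M I × (∀ x → x ∉ I → ¬ Independent M (⁅ x ⁆ ∪ I))

basis-exists : (M : Matroid) → ∃ (IsBasis M)
basis-exists M with rank-attained M ⊤
... | I , _ , ind , rank≡∣I∣ = I , ind , maximal
  where
  maximal : ∀ x → x ∉ I → ¬ Independent M (⁅ x ⁆ ∪ I)
  maximal x x∉I ind′ = ℕ.<⇒≱ (ℕ.≤-reflexive (sym (∣⁅x⁆∪p∣≡1+∣p∣ I x∉I)))
    (subst (∣ ⁅ x ⁆ ∪ I ∣ ≤_) rank≡∣I∣ (rank-≥ M ⊆⊤ ind′))

module FundamentalCircuits (M : Matroid) {I : Subset (n M)} (I-basis : IsBasis M I) where

  private
    C : Fin (m M) → Subset (n M)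
    C = circ M

  Fundamental : Fin (m M) → Set
  Fundamental j = ∃ λ w → C j ⊆ ⁅ w ⁆ ∪ I

  fundamental-circuit : ∀ {x} → x ∉ I → ∃ λ j → C j ⊆ ⁅ x ⁆ ∪ I × x ∈ C j
  fundamental-circuit {x} x∉I with ¬Independent⇒∃⊆ M (proj₂ I-basis x x∉I)
  ... | j , Cj⊆ with x ∈? C j
  ...   | yes x∈Cj = j , Cj⊆ , x∈Cj
  ...   | no x∉Cj  = ⊥-elim (proj₁ I-basis j Cj⊆I)
    where
    Cj⊆I : C j ⊆ I
    Cj⊆I {y} y∈Cj with x∈p∪q⁻ ⁅ x ⁆ I (Cj⊆ y∈Cj)
    ... | inj₁ y∈⁅x⁆ = ⊥-elim (x∉Cj (subst (_∈ C j) (x∈⁅y⁆⇒x≡y x y∈⁅x⁆) y∈Cj))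
    ... | inj₂ y∈I   = y∈I

  ⊆⁅w⁆∪I⇒─I⊆⁅w⁆ : ∀ {S w} → S ⊆ ⁅ w ⁆ ∪ I → S ─ I ⊆ ⁅ w ⁆
  ⊆⁅w⁆∪I⇒─I⊆⁅w⁆ {S} S⊆ y∈S─I with x∈p─q⁻ S I y∈S─I
  ... | y∈S , y∉I with x∈p∪q⁻ _ I (S⊆ y∈S)
  ...   | inj₁ y∈⁅w⁆ = y∈⁅w⁆
  ...   | inj₂ y∈I   = ⊥-elim (y∉I y∈I)

  Fundamental⇒∣C─I∣≤1 : ∀ {j} → Fundamental j → ∣ C j ─ I ∣ ≤ 1
  Fundamental⇒∣C─I∣≤1 (w , Cj⊆) = subst (_ ≤_) (∣⁅x⁆∣≡1 w) (p⊆q⇒∣p∣≤∣q∣ (⊆⁅w⁆∪I⇒─I⊆⁅w⁆ Cj⊆))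

  ∣C─I∣≤1⇒Fundamental : ∀ {j} → ∣ C j ─ I ∣ ≤ 1 → Fundamental j
  ∣C─I∣≤1⇒Fundamental {j} ∣Cj─I∣≤1 with ⊈⇒∃∉ (proj₁ I-basis j)
  ... | w , w∈Cj , w∉I = w , Cj⊆
    where
    Cj⊆ : C j ⊆ ⁅ w ⁆ ∪ I
    Cj⊆ {y} y∈Cj with y ∈? I | y ≟ w
    ... | yes y∈I | _        = x∈p∪q⁺ (inj₂ y∈I)
    ... | no _    | yes refl = x∈p∪q⁺ (inj₁ (x∈⁅x⁆ y))
    ... | no y∉I  | no y≢w   = ⊥-elim (ℕ.<⇒≱ (x≢y⇒2≤∣p∣ y≢w (x∈p∧x∉q⇒x∈p─q y∈Cj y∉I)
                                                            (x∈p∧x∉q⇒x∈p─q w∈Cj w∉I)) ∣Cj─I∣≤1)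

  two-fundamental-outside : ∀ {P Q} → (F₁ : Fundamental P) → (F₂ : Fundamental Q) →
                            (C P ∪ C Q) ─ I ⊆ ⁅ proj₁ F₁ ⁆ ∪ ⁅ proj₁ F₂ ⁆
  two-fundamental-outside {P} {Q} (a , CP⊆) (b , CQ⊆) y∈ with x∈p─q⁻ (C P ∪ C Q) I y∈
  ... | y∈CP∪CQ , y∉I with x∈p∪q⁻ (C P) (C Q) y∈CP∪CQ
  ...   | inj₁ y∈CP = x∈p∪q⁺ (inj₁ (⊆⁅w⁆∪I⇒─I⊆⁅w⁆ CP⊆ (x∈p∧x∉q⇒x∈p─q y∈CP y∉I)))
  ...   | inj₂ y∈CQ = x∈p∪q⁺ (inj₂ (⊆⁅w⁆∪I⇒─I⊆⁅w⁆ CQ⊆ (x∈p∧x∉q⇒x∈p─q y∈CQ y∉I)))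

module _ (M : Matroid) (4≤m : 4 ≤ m M) (𝒜₀⇒≡⊤ : ∀ A → 𝒜 M 0 A → A ≡ ⊤)
         {I : Subset (n M)} (I-basis : IsBasis M I) where

  private
    C : Fin (m M) → Subset (n M)
    C = circ M

  open FundamentalCircuits M I-basis

  -- {P, Q, G} is a set of three circuits with nullity(P ∪ Q ∪ G) ≤ 2, hence in 𝒜₀, but it is
  -- not the set of all (at least four) circuits.
  fundamentals-disjoint : ∀ {P Q} → P ≢ Q → Fundamental P → Fundamental Q → Empty (C P ∩ C Q)
  fundamentals-disjoint {P} {Q} P≢Q P-fund Q-fund (z , z∈CP∩CQ)
    with x∈p∩q⁻ (C P) (C Q) z∈CP∩CQ
  ... | z∈CP , z∈CQ with elimination-third M P≢Q z∈CP z∈CQ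
  ...   | G , G≢P , G≢Q , CG⊆ = ℕ.<⇒≱ 4≤m (ℕ.≤-reflexive m≡3)
    where
    A : Subset (m M)
    A = ⁅ P ⁆ ∪ ⁅ Q ⁆ ∪ ⁅ G ⁆
    ∣A∣≡3 : ∣ A ∣ ≡ 3
    ∣A∣≡3 = ∣⁅x⁆∪⁅y⁆∪⁅z⁆∣≡3 P≢Q (G≢P ∘ sym) (G≢Q ∘ sym)
    ⋃A⊆CP∪CQ : unionOf M A ⊆ C P ∪ C Q
    ⋃A⊆CP∪CQ y∈⋃A with x∈unionOf⁻ M {A} y∈⋃A
    ... | i , i∈A , y∈Ci with x∈⁅a⁆∪⁅b⁆∪⁅c⁆⁻ i∈A
    ...   | inj₁ refl        = x∈p∪q⁺ (inj₁ y∈Ci)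
    ...   | inj₂ (inj₁ refl) = x∈p∪q⁺ (inj₂ y∈Ci)
    ...   | inj₂ (inj₂ refl) = proj₁ (x∈p-y⁻ _ (CG⊆ y∈Ci))
    nullity≤2 : nullity M (unionOf M A) ≤ 2
    nullity≤2 = ℕ.≤-trans (nullity≤∣S─J∣ M _ (proj₁ I-basis))
      (p⊆⁅x⁆∪⁅y⁆⇒∣p∣≤2 λ y∈ → let (y∈⋃A , y∉I) = x∈p─q⁻ _ I y∈ in
        two-fundamental-outside P-fund Q-fund (x∈p∧x∉q⇒x∈p─q (⋃A⊆CP∪CQ y∈⋃A) y∉I))
    A≡⊤ : A ≡ ⊤
    A≡⊤ = 𝒜₀⇒≡⊤ A (subst (nullity M (unionOf M A) <_) (sym ∣A∣≡3) (s≤s nullity≤2))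
    m≡3 : m M ≡ 3
    m≡3 = trans (sym (∣⊤∣≡n (m M))) (trans (cong ∣_∣ (sym A≡⊤)) ∣A∣≡3)

  -- Eliminating x ∈ D ∖ I against its fundamental circuit F gives G with G ∖ I ⊂ D ∖ I; if G
  -- were fundamental it would either meet F or lie inside D.
  smaller-non-fundamental : ∀ D → 2 ≤ ∣ C D ─ I ∣ →
                            ∃ λ G → ∣ C G ─ I ∣ < ∣ C D ─ I ∣ × ¬ Fundamental G
  smaller-non-fundamental D 2≤∣CD─I∣
    with 0<∣p∣⇒Nonempty (C D ─ I) (ℕ.≤-trans (s≤s z≤n) 2≤∣CD─I∣)
  ... | x , x∈CD─I with x∈p─q⁻ (C D) I x∈CD─I
  ...   | x∈CD , x∉I with fundamental-circuit x∉I
  ...     | F , CF⊆ , x∈CF with elimination-third M D≢F x∈CD x∈CF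
    where
    D≢F : D ≢ F
    D≢F refl = ℕ.<⇒≱ 2≤∣CD─I∣ (Fundamental⇒∣C─I∣≤1 (x , CF⊆))
  ...       | G , G≢D , G≢F , CG⊆ = G , p⊂q⇒∣p∣<∣q∣ CG─I⊂CD─I , ¬G-fund
    where
    CG─I⊂CD─I : C G ─ I ⊂ C D ─ I
    CG─I⊂CD─I = CG─I⊆CD─I , x , x∈CD─I , λ x∈CG─I → x∉p-x _ (CG⊆ (proj₁ (x∈p─q⁻ _ I x∈CG─I)))
      where
      CG─I⊆CD─I : C G ─ I ⊆ C D ─ I
      CG─I⊆CD─I y∈CG─I with x∈p─q⁻ (C G) I y∈CG─I
      ... | y∈CG , y∉I with x∈p-y⁻ _ (CG⊆ y∈CG)
      ...   | y∈CD∪CF , y≢x with x∈p∪q⁻ (C D) (C F) y∈CD∪CF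
      ...     | inj₁ y∈CD = x∈p∧x∉q⇒x∈p─q y∈CD y∉I
      ...     | inj₂ y∈CF = ⊥-elim (y≢x (x∈⁅y⁆⇒x≡y x (⊆⁅w⁆∪I⇒─I⊆⁅w⁆ CF⊆ (x∈p∧x∉q⇒x∈p─q y∈CF y∉I))))
    ¬G-fund : ¬ Fundamental G
    ¬G-fund G-fund with nonempty? (C G ∩ C F)
    ... | yes meet    = fundamentals-disjoint G≢F G-fund (x , CF⊆) meet
    ... | no disjoint = G≢D (incomparable M G D CG⊆CD)
      where
      CG⊆CD : C G ⊆ C D
      CG⊆CD {y} y∈CG with x∈p∪q⁻ (C D) (C F) (proj₁ (x∈p-y⁻ _ (CG⊆ y∈CG)))
      ... | inj₁ y∈CD = y∈CD
      ... | inj₂ y∈CF = ⊥-elim (disjoint (y , x∈p∩q⁺ (y∈CG , y∈CF)))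

  fundamental-below : ∀ d j → ∣ C j ─ I ∣ < d → Fundamental j
  fundamental-below zero    j ()
  fundamental-below (suc d) j ∣Cj─I∣≤d with 2 ℕ.≤? ∣ C j ─ I ∣
  ... | no ¬2≤ = ∣C─I∣≤1⇒Fundamental (ℕ.≤-pred (ℕ.≰⇒> ¬2≤))
  ... | yes 2≤ with smaller-non-fundamental j 2≤
  ...   | G , smaller , ¬G-fund =
    ⊥-elim (¬G-fund (fundamental-below d G (ℕ.<-≤-trans smaller (ℕ.≤-pred ∣Cj─I∣≤d))))

  all-fundamental : ∀ j → Fundamental j
  all-fundamental j = fundamental-below _ j ℕ.≤-refl

  circuits-disjoint : ∀ {P Q} → P ≢ Q → Empty (C P ∩ C Q)
  circuits-disjoint P≢Q = fundamentals-disjoint P≢Q (all-fundamental _) (all-fundamental _)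

connected⇒¬𝒜₀⇒≡⊤ : (M : Matroid) → Connected M → 4 ≤ m M → ¬ (∀ A → 𝒜 M 0 A → A ≡ ⊤)
connected⇒¬𝒜₀⇒≡⊤ M conn 4≤m 𝒜₀⇒≡⊤
  with basis-exists M | connected⇒meeting-pair M conn (ℕ.≤-trans (s≤s (s≤s z≤n)) 4≤m)
... | _ , I-basis | _ , _ , P≢Q , meet = circuits-disjoint M 4≤m 𝒜₀⇒≡⊤ I-basis P≢Q meet

δ≅U[k,1+k]⇒Tricycle : (M : Matroid) → Connected M → ∀ k → δ M ≅ U k (suc k) → Tricycle M × k ≡ 2
δ≅U[k,1+k]⇒Tricycle M conn 0 iso =
  ⊥-elim (subsingleton⇒δ-free M (↔Fin1⇒subsingleton (proj₁ iso)) ⊤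
                              (Equivalence.from (≅U[k,1+k]⇒Dep⇔≡⊤ iso ⊤) refl))
δ≅U[k,1+k]⇒Tricycle M conn 1 iso =
  ⊥-elim (ℕ.<⇒≱ (connected⇒3≤m M conn (ℕ.≤-reflexive (sym m≡2))) (ℕ.≤-reflexive m≡2))
  where
  m≡2 : m M ≡ 2
  m≡2 = ↔⇒≡ (proj₁ iso)
δ≅U[k,1+k]⇒Tricycle M conn 2 iso = connected⇒Tricycle M conn (↔⇒≡ (proj₁ iso)) , refl
δ≅U[k,1+k]⇒Tricycle M conn (suc (suc (suc k))) iso = ⊥-elim (connected⇒¬𝒜₀⇒≡⊤ M conn 4≤m 𝒜₀⇒≡⊤)
  where
  4≤m : 4 ≤ m M
  4≤m = subst (4 ≤_) (sym (↔⇒≡ (proj₁ iso))) (s≤s (s≤s (s≤s (s≤s z≤n))))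
  𝒜₀⇒≡⊤ : ∀ A → 𝒜 M 0 A → A ≡ ⊤
  𝒜₀⇒≡⊤ A A∈𝒜₀ = Equivalence.to (≅U[k,1+k]⇒Dep⇔≡⊤ iso A) (0 , A∈𝒜₀)

mainTheorem9 : (M : Matroid) → Connected M →
    ((δ M ≅ emptyM) ⇔ (toDS M ≅ U 1 1)) ×
    ((δ M ≅ U 1 1) ⇔ (∃ λ k → toDS M ≅ U k (suc k))) ×
    (∀ k → (δ M ≅ U k (suc k)) ⇔ (Tricycle M × k ≡ 2))
mainTheorem9 M conn =
  mk⇔ (δ≅∅⇒≅U₁₁ M conn) (≅U₁₁⇒δ≅∅ M) ,
  mk⇔ (δ≅U₁₁⇒≅U[k,1+k] M conn) (λ (k , iso) → ≅U[k,1+k]⇒δ≅U₁₁ M k iso) ,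
  λ k → mk⇔ (δ≅U[k,1+k]⇒Tricycle M conn k) λ { (tricycle , refl) → Tricycle⇒δ≅U₂₃ M tricycle }
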